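{- There exists a super-simple $(4,2)$-DGDD of type $6^5$ with $d\ge\frac12$.
   Context: A $(4,2)$-DGDD of type $6^5$ is a triple $(X,\mathcal{G},\mathcal{B})$ where $X$ is partitioned into $5$ groups of size $6$ and $\mathcal{B}$ is a collection of ordered $4$-tuples of distinct points such that each ordered pair $(x,y)$ of points from different groups appears in exactly $2$ blocks ($(x,y)$ appears in $(a_1,\dots,a_4)$ if $x=a_i,y=a_j$, $i<j$), and no two points of the same group lie in a common block. It is super-simple if any two blocks, viewed as sets, share at most two points. A defining set is a subset of $\mathcal{B}$ contained in a unique such DGDD with the same points and groups; $d$ is the size of a smallest defining set divided by $|\mathcal{B}|$. -}

module Defs where

open import Data.Nat using (ℕ; _≤_)
open import Data.Fin using (Fin)
open import Data.Fin.Properties using () renaming (_≟_ to _≟ᶠ_)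
open import Data.Product using (_×_; _,_; proj₁; ∃)
open import Data.Product.Properties using (≡-dec)
open import Data.List using (List; []; _∷_; length; filter; _++_; lookup)
open import Data.List.Relation.Binary.Permutation.Propositional using (_↭_)
open import Data.Vec using (Vec; _∷_; []; toList)
import Data.Vec as V
open import Relation.Binary.PropositionalEquality using (_≡_; _≢_)
open import Relation.Binary.Definitions using (DecidableEquality)
import Data.List.Membership.DecPropositional as DecMem

-- The point set X = Fin 5 × Fin 6; the group of a point is its first
-- component, so there are 5 groups of size 6 (type 6^5).
Point : Set
Point = Fin 5 × Fin 6

group : Point → Fin 5
group = proj₁

_≟ₚ_ : DecidableEquality Point
_≟ₚ_ = ≡-dec _≟ᶠ_ _≟ᶠ_

_≟ₚₚ_ : DecidableEquality (Point × Point)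
_≟ₚₚ_ = ≡-dec _≟ₚ_ _≟ₚ_

Block : Set
Block = Vec Point 4

-- A block meets each group at most once (this also forces the 4 points
-- to be distinct).
GoodBlock : Block → Set
GoodBlock b = ∀ (i j : Fin 4) → i ≢ j → group (V.lookup b i) ≢ group (V.lookup b j)

orderedPairs : Block → List (Point × Point)
orderedPairs (a ∷ b ∷ c ∷ d ∷ []) =
  (a , b) ∷ (a , c) ∷ (a , d) ∷ (b , c) ∷ (b , d) ∷ (c , d) ∷ []

module MP  = DecMem _≟ₚ_
module MPP = DecMem _≟ₚₚ_

pairCount : List Block → Point → Point → ℕ
pairCount B x y = length (filter (λ b → (x , y) MPP.∈? orderedPairs b) B)

-- A (4,2)-DGDD of type 6^5 on the fixed point set / groups above; the
-- collection of blocks is a list (a multiset, up to permutation).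
IsDGDD : List Block → Set
IsDGDD B =
  (∀ (k : Fin (length B)) → GoodBlock (lookup B k)) ×
  (∀ (x y : Point) → group x ≢ group y → pairCount B x y ≡ 2)

common : Block → Block → ℕ
common b c = length (filter (λ p → p MP.∈? toList c) (toList b))

SuperSimple : List Block → Set
SuperSimple B = ∀ (k l : Fin (length B)) → k ≢ l → common (lookup B k) (lookup B l) ≤ 2

_⊆ₘ_ : List Block → List Block → Set
S ⊆ₘ B = ∃ λ R → (S ++ R) ↭ B

IsDefiningSet : List Block → List Block → Set
IsDefiningSet B S = S ⊆ₘ B × (∀ (B' : List Block) → IsDGDD B' → S ⊆ₘ B' → B' ↭ B)

{-# OPTIONS --safe #-}
module Submission where

-- The 240 blocks of the design below form 120 trades {(p,q,r,s), (q,p,u,v)}.  Swapping the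
-- first two points of both blocks gives (q,p,r,s), (p,q,u,v): the pair (p,q) moves from the
-- first block to the second and (q,p) the other way, so the ordered pairs covered do not
-- change and the result is again a DGDD.  It is a different DGDD, because (q,p,r,s) has the
-- same points as (p,q,r,s) and so cannot be a block of a super-simple design.  Hence every
-- defining set contains a block of every trade, and since the 240 blocks are distinct it has
-- at least 120 = |B|/2 blocks.  That the design is a super-simple DGDD is checked by
-- computation.

open import Defs
open import Data.Nat using (ℕ; suc; _+_; _*_; _/_; _≤_; _≟_; _≤?_; z≤n; s≤s)
open import Data.Nat.DivMod using (_mod_)
open import Data.Nat.Properties using (+-mono-≤; ≤-trans; *-monoʳ-≤; module ≤-Reasoning)
open import Data.Fin using (Fin; zero; suc; #_)
import Data.Fin.Properties as Fin
open import Data.Product using (∃; _×_; _,_; proj₁; proj₂)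
import Data.Product as Product
open import Data.Sum using (_⊎_; inj₁; inj₂)
import Data.Sum as Sum
open import Data.List using (List; []; _∷_; [_]; _++_; length; filter; lookup; map; concatMap; upTo)
open import Data.List.Properties using (filter-++; length-++; filter-some; filter-accept; filter-reject; filter-all)
open import Data.List.Relation.Unary.All using (All; []; _∷_; all?)
import Data.List.Relation.Unary.All as All
open import Data.List.Relation.Unary.All.Properties using (¬Any⇒All¬; ++⁺; ++⁻ˡ; ++⁻ʳ; map⁺)
open import Data.List.Relation.Unary.Any using (Any; here; there; any?)
import Data.List.Relation.Unary.Any as Any
open import Data.List.Relation.Unary.Any.Properties using (lookup-index)
open import Data.List.Relation.Unary.AllPairs using (AllPairs; []; _∷_; allPairs?)
import Data.List.Relation.Unary.AllPairs as AllPairs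
open import Data.List.Relation.Unary.Unique.Propositional using (Unique)
import Data.List.Relation.Unary.Unique.Propositional.Properties as Unique
open import Data.List.Relation.Binary.Pointwise using (Pointwise; []; _∷_)
open import Data.List.Membership.Propositional using (_∈_; _∉_)
open import Data.List.Membership.Propositional.Properties using (∈-∃++; ∈-++⁻; ∈-lookup; ∈-filter⁻; ∈-AllPairs₂)
import Data.List.Membership.DecPropositional as DecMembership
open import Data.List.Relation.Binary.Permutation.Propositional using (_↭_; ↭-refl; ↭-sym; ↭-trans; ↭-prep; ↭-swap)
open import Data.List.Relation.Binary.Permutation.Propositional.Properties
  using (∈-resp-↭; ↭-length; shift; shifts; drop-∷; ++⁺ˡ; ++⁺ʳ; ++-comm; filter-↭; All-resp-↭)
open import Data.Vec using (_∷_; []; toList)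
import Data.Vec as Vec
open import Data.Vec.Properties using (∷-injectiveˡ)
import Data.Vec.Properties as Vecₚ
open import Function using (_∘_; id; case_of_)
open import Function.Bundles using (_⇔_; mk⇔; Equivalence)
open import Function.Construct.Composition using (_⇔-∘_)
open import Relation.Binary.Definitions using (Symmetric; DecidableEquality)
open import Relation.Binary.PropositionalEquality using (_≡_; _≢_; refl; sym; trans; cong; subst; module ≡-Reasoning)
open import Relation.Nullary using (Dec; ¬_; yes; no; ¬?; contradiction)
open import Relation.Nullary.Decidable using (_⊎-dec_; _×-dec_; _→-dec_; map′; toWitness)
open import Relation.Unary using (Decidable)

module _ {A : Set} where

  Unique⇒length≤ : ∀ {xs ys : List A} → Unique xs → (∀ {x} → x ∈ xs → x ∈ ys) →
                   length xs ≤ length ys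
  Unique⇒length≤ [] _ = z≤n
  Unique⇒length≤ {x ∷ xs} {ys} (x≢xs ∷ unique) xs⊆ys
    with as , bs , refl ← ∈-∃++ (xs⊆ys (here refl)) = begin
      suc (length xs)            ≤⟨ s≤s (Unique⇒length≤ unique xs⊆as++bs) ⟩
      suc (length (as ++ bs))    ≡⟨ ↭-length (shift x as bs) ⟨
      length (as ++ [ x ] ++ bs) ∎
    where
    open ≤-Reasoning
    xs⊆as++bs : ∀ {z} → z ∈ xs → z ∈ as ++ bs
    xs⊆as++bs z∈xs with ∈-resp-↭ (shift x as bs) (xs⊆ys (there z∈xs))
    ... | here z≡x       = contradiction (sym z≡x) (All.lookup x≢xs z∈xs)
    ... | there z∈as++bs = z∈as++bs

  AllPairs-lookup : ∀ {R : A → A → Set} {xs} → Symmetric R → AllPairs R xs →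
                    ∀ {k l} → k ≢ l → R (lookup xs k) (lookup xs l)
  AllPairs-lookup sym-R (_ ∷ _)        {zero}  {zero}  k≢l = contradiction refl k≢l
  AllPairs-lookup sym-R (x~xs ∷ _)     {zero}  {suc l} _   = All.lookup x~xs (∈-lookup l)
  AllPairs-lookup sym-R (x~xs ∷ _)     {suc k} {zero}  _   = sym-R (All.lookup x~xs (∈-lookup k))
  AllPairs-lookup sym-R (_ ∷ xs-pairs) {suc k} {suc l} k≢l =
    AllPairs-lookup sym-R xs-pairs (k≢l ∘ cong suc)

  All⇒∀lookup : ∀ {P : A → Set} {xs} → All P xs → ∀ k → P (lookup xs k)
  All⇒∀lookup all k = All.lookup all (∈-lookup k)

  ∀lookup⇒All : ∀ {P : A → Set} {xs} → (∀ k → P (lookup xs k)) → All P xs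
  ∀lookup⇒All {P} P[xs] =
    All.tabulate λ x∈xs → subst P (sym (lookup-index x∈xs)) (P[xs] (Any.index x∈xs))

  ∈-↭-⇔ : ∀ {x : A} {xs ys} → xs ↭ ys → (x ∈ xs) ⇔ (x ∈ ys)
  ∈-↭-⇔ xs↭ys = mk⇔ (∈-resp-↭ xs↭ys) (∈-resp-↭ (↭-sym xs↭ys))

  ∈-∷-⇔-head : ∀ {x a b : A} {xs} → x ≢ a → x ≢ b → (x ∈ a ∷ xs) ⇔ (x ∈ b ∷ xs)
  ∈-∷-⇔-head x≢a x≢b = mk⇔
    (λ { (here x≡a) → contradiction x≡a x≢a ; (there x∈xs) → there x∈xs })
    (λ { (here x≡b) → contradiction x≡b x≢b ; (there x∈xs) → there x∈xs })

  ∈-∷-⇔-tail : ∀ {x a : A} {xs ys} → x ∉ xs → x ∉ ys → (x ∈ a ∷ xs) ⇔ (x ∈ a ∷ ys)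
  ∈-∷-⇔-tail x∉xs x∉ys = mk⇔
    (λ { (here x≡a) → here x≡a ; (there x∈xs) → contradiction x∈xs x∉xs })
    (λ { (here x≡a) → here x≡a ; (there x∈ys) → contradiction x∈ys x∉ys })

module _ {A B : Set} (f : A → List B) where

  ∈-concatMap-↭ : ∀ {x xs} → x ∈ xs → ∃ λ ys → concatMap f xs ↭ f x ++ ys
  ∈-concatMap-↭ {xs = _ ∷ xs} (here refl) = concatMap f xs , ↭-refl
  ∈-concatMap-↭ {x} {y ∷ _} (there x∈xs) =
    let ys , ↭f[x]++ys = ∈-concatMap-↭ x∈xs
    in f y ++ ys , ↭-trans (++⁺ˡ (f y) ↭f[x]++ys) (shifts (f y) (f x))

  length≤-filter-concatMap : ∀ {P : B → Set} (P? : Decidable P) {xs} →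
    All (Any P ∘ f) xs → length xs ≤ length (filter P? (concatMap f xs))
  length≤-filter-concatMap P? [] = z≤n
  length≤-filter-concatMap P? {x ∷ xs} (hit ∷ hits) = begin
    1 + length xs
      ≤⟨ +-mono-≤ (filter-some P? hit) (length≤-filter-concatMap P? hits) ⟩
    length (filter P? (f x)) + length (filter P? (concatMap f xs))
      ≡⟨ length-++ (filter P? (f x)) ⟨
    length (filter P? (f x) ++ filter P? (concatMap f xs))
      ≡⟨ cong length (filter-++ P? (f x) (concatMap f xs)) ⟨
    length (filter P? (concatMap f (x ∷ xs))) ∎
    where open ≤-Reasoning

  length≤-hittingSet : DecidableEquality B → ∀ {xs S} → Unique (concatMap f xs) →
    All (λ x → Any (_∈ S) (f x)) xs → length xs ≤ length S
  length≤-hittingSet _≟_ {xs} {S} unique hits =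
    ≤-trans (length≤-filter-concatMap (_∈? S) hits)
            (Unique⇒length≤ (Unique.filter⁺ (_∈? S) unique) hits⊆S)
    where
    open DecMembership _≟_ using (_∈?_)
    hits⊆S : ∀ {y} → y ∈ filter (_∈? S) (concatMap f xs) → y ∈ S
    hits⊆S = proj₂ ∘ ∈-filter⁻ (_∈? S) {xs = concatMap f xs}

⊆ₘ-resp-↭ : ∀ {S B B'} → B ↭ B' → S ⊆ₘ B → S ⊆ₘ B'
⊆ₘ-resp-↭ B↭B' (R , S++R↭B) = R , ↭-trans S++R↭B B↭B'

⊆ₘ-++⁺ˡ : ∀ {S ys} xs → S ⊆ₘ ys → S ⊆ₘ (xs ++ ys)
⊆ₘ-++⁺ˡ {S} xs (R , S++R↭ys) = xs ++ R , ↭-trans (shifts S xs) (++⁺ˡ xs S++R↭ys)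

⊆ₘ-∷⁻ : ∀ {S x ys} → x ∉ S → S ⊆ₘ (x ∷ ys) → S ⊆ₘ ys
⊆ₘ-∷⁻ {S} {x} x∉S (R , S++R↭x∷ys) with ∈-++⁻ S (∈-resp-↭ (↭-sym S++R↭x∷ys) (here refl))
... | inj₁ x∈S = contradiction x∈S x∉S
... | inj₂ x∈R with R₁ , R₂ , refl ← ∈-∃++ x∈R =
  R₁ ++ R₂ , drop-∷ (↭-trans (↭-sym S++R↭x∷S++R₁++R₂) S++R↭x∷ys)
  where
  S++R↭x∷S++R₁++R₂ : S ++ R₁ ++ [ x ] ++ R₂ ↭ x ∷ S ++ R₁ ++ R₂
  S++R↭x∷S++R₁++R₂ = ↭-trans (++⁺ˡ S (shift x R₁ R₂)) (shift x S (R₁ ++ R₂))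

⊆ₘ-++⁻ : ∀ {S xs ys} → All (_∉ S) xs → S ⊆ₘ (xs ++ ys) → S ⊆ₘ ys
⊆ₘ-++⁻ []            = id
⊆ₘ-++⁻ (x∉S ∷ xs∉S) = ⊆ₘ-++⁻ xs∉S ∘ ⊆ₘ-∷⁻ x∉S

swapFront : Block → Block
swapFront (a ∷ b ∷ cs) = b ∷ a ∷ cs

swapIndex : Fin 4 → Fin 4
swapIndex zero          = suc zero
swapIndex (suc zero)    = zero
swapIndex (suc (suc i)) = suc (suc i)

swapIndex-involutive : ∀ i → swapIndex (swapIndex i) ≡ i
swapIndex-involutive zero          = refl
swapIndex-involutive (suc zero)    = refl
swapIndex-involutive (suc (suc i)) = refl

lookup-swapFront : ∀ b i → Vec.lookup (swapFront b) i ≡ Vec.lookup b (swapIndex i)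
lookup-swapFront (_ ∷ _ ∷ _) zero          = refl
lookup-swapFront (_ ∷ _ ∷ _) (suc zero)    = refl
lookup-swapFront (_ ∷ _ ∷ _) (suc (suc i)) = refl

GoodBlock-swapFront : ∀ {b} → GoodBlock b → GoodBlock (swapFront b)
GoodBlock-swapFront {b} good i j i≢j
  rewrite lookup-swapFront b i | lookup-swapFront b j =
  good (swapIndex i) (swapIndex j) (i≢j ∘ swapIndex-injective)
  where
  swapIndex-injective : swapIndex i ≡ swapIndex j → i ≡ j
  swapIndex-injective eq = begin
    i                         ≡⟨ swapIndex-involutive i ⟨
    swapIndex (swapIndex i)   ≡⟨ cong swapIndex eq ⟩
    swapIndex (swapIndex j)   ≡⟨ swapIndex-involutive j ⟩
    j                         ∎
    where open ≡-Reasoning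

-- orderedPairs (a ∷ b ∷ c ∷ d ∷ []) is (a , b) ∷ tailPairs (a ∷ b ∷ c ∷ d ∷ []) by definition.
tailPairs : Block → List (Point × Point)
tailPairs (a ∷ b ∷ c ∷ d ∷ []) = (a , c) ∷ (a , d) ∷ (b , c) ∷ (b , d) ∷ (c , d) ∷ []

orderedPairs-swapFront : ∀ a b c d →
  orderedPairs (swapFront (a ∷ b ∷ c ∷ d ∷ [])) ↭ (b , a) ∷ tailPairs (a ∷ b ∷ c ∷ d ∷ [])
orderedPairs-swapFront a b c d =
  ↭-prep (b , a) (++⁺ʳ [ c , d ] (++-comm ((b , c) ∷ (b , d) ∷ []) ((a , c) ∷ (a , d) ∷ [])))

second-∈-tailPairs : ∀ {a b c d x y} → (x , y) ∈ tailPairs (a ∷ b ∷ c ∷ d ∷ []) → y ≡ c ⊎ y ≡ d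
second-∈-tailPairs (here refl)                                 = inj₁ refl
second-∈-tailPairs (there (here refl))                         = inj₂ refl
second-∈-tailPairs (there (there (here refl)))                 = inj₁ refl
second-∈-tailPairs (there (there (there (here refl))))         = inj₂ refl
second-∈-tailPairs (there (there (there (there (here refl))))) = inj₂ refl

front∉tailPairs : ∀ {a b c d x y} → GoodBlock (a ∷ b ∷ c ∷ d ∷ []) → y ≡ a ⊎ y ≡ b →
                  (x , y) ∉ tailPairs (a ∷ b ∷ c ∷ d ∷ [])
front∉tailPairs good y∈ab xy∈tail with y∈ab | second-∈-tailPairs xy∈tail
... | inj₁ refl | inj₁ refl = good (# 0) (# 2) (λ ()) refl
... | inj₁ refl | inj₂ refl = good (# 0) (# 3) (λ ()) refl
... | inj₂ refl | inj₁ refl = good (# 1) (# 2) (λ ()) refl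
... | inj₂ refl | inj₂ refl = good (# 1) (# 3) (λ ()) refl

pairCount-++ : ∀ B B' x y → pairCount (B ++ B') x y ≡ pairCount B x y + pairCount B' x y
pairCount-++ B B' x y = trans (cong length (filter-++ _ B B')) (length-++ (filter _ B))

pairCount-resp-↭ : ∀ {B B'} → B ↭ B' → ∀ x y → pairCount B x y ≡ pairCount B' x y
pairCount-resp-↭ B↭B' x y = ↭-length (filter-↭ _ B↭B')

pairCount-accept : ∀ {b B x y} → (x , y) ∈ orderedPairs b → pairCount (b ∷ B) x y ≡ suc (pairCount B x y)
pairCount-accept {x = x} {y} xy∈b = cong length (filter-accept (λ b → (x , y) MPP.∈? orderedPairs b) xy∈b)

pairCount-reject : ∀ {b B x y} → (x , y) ∉ orderedPairs b → pairCount (b ∷ B) x y ≡ pairCount B x y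
pairCount-reject {x = x} {y} xy∉b = cong length (filter-reject (λ b → (x , y) MPP.∈? orderedPairs b) xy∉b)

pairCount-cong : ∀ {x y B B'} →
  Pointwise (λ b b' → (x , y) ∈ orderedPairs b ⇔ (x , y) ∈ orderedPairs b') B B' →
  pairCount B x y ≡ pairCount B' x y
pairCount-cong [] = refl
pairCount-cong {x} {y} {b ∷ B} {b' ∷ B'} (b⇔b' ∷ B≈B') =
  case (x , y) MPP.∈? orderedPairs b of λ
    { (yes xy∈b) → begin
        pairCount (b ∷ B) x y     ≡⟨ pairCount-accept xy∈b ⟩
        suc (pairCount B x y)     ≡⟨ cong suc (pairCount-cong B≈B') ⟩
        suc (pairCount B' x y)    ≡⟨ pairCount-accept (Equivalence.to b⇔b' xy∈b) ⟨
        pairCount (b' ∷ B') x y   ∎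
    ; (no xy∉b) → begin
        pairCount (b ∷ B) x y     ≡⟨ pairCount-reject xy∉b ⟩
        pairCount B x y           ≡⟨ pairCount-cong B≈B' ⟩
        pairCount B' x y          ≡⟨ pairCount-reject (xy∉b ∘ Equivalence.from b⇔b') ⟨
        pairCount (b' ∷ B') x y   ∎
    }
  where open ≡-Reasoning

record Trade : Set where
  constructor trade
  field p q r s u v : Point

block₁ block₂ : Trade → Block
block₁ (trade p q r s u v) = p ∷ q ∷ r ∷ s ∷ []
block₂ (trade p q r s u v) = q ∷ p ∷ u ∷ v ∷ []

blocks : Trade → List Block
blocks t = block₁ t ∷ block₂ t ∷ []

-- If y ∈ {p, q}, then (x , y) is no tail pair of either block and the swapped blocks cover
-- it crosswise; otherwise (x , y) is neither front pair and each block covers it iff its swap does.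
pairCount-exchange : ∀ t → All GoodBlock (blocks t) → ∀ x y →
  pairCount (map swapFront (blocks t)) x y ≡ pairCount (blocks t) x y
pairCount-exchange t@(trade p q r s u v) (good₁ ∷ good₂ ∷ []) x y =
  case (y ≟ₚ p) ⊎-dec (y ≟ₚ q) of λ
    { (yes y∈pq) → crossed y∈pq
    ; (no y∉pq)  → parallel y∉pq
    }
  where
  b₁ = block₁ t
  b₂ = block₂ t

  crossed : y ≡ p ⊎ y ≡ q → pairCount (map swapFront (blocks t)) x y ≡ pairCount (blocks t) x y
  crossed y∈pq = begin
    pairCount (swapFront b₁ ∷ swapFront b₂ ∷ []) x y
      ≡⟨ pairCount-cong (b₁'⇔b₂ ∷ b₂'⇔b₁ ∷ []) ⟩
    pairCount (b₂ ∷ b₁ ∷ []) x y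
      ≡⟨ pairCount-resp-↭ (↭-swap b₂ b₁ ↭-refl) x y ⟩
    pairCount (b₁ ∷ b₂ ∷ []) x y ∎
    where
    open ≡-Reasoning
    xy∉tail₁ = front∉tailPairs good₁ y∈pq
    xy∉tail₂ = front∉tailPairs good₂ (Sum.swap y∈pq)
    b₁'⇔b₂ : (x , y) ∈ orderedPairs (swapFront b₁) ⇔ (x , y) ∈ orderedPairs b₂
    b₁'⇔b₂ = ∈-∷-⇔-tail xy∉tail₁ xy∉tail₂ ⇔-∘ ∈-↭-⇔ (orderedPairs-swapFront p q r s)
    b₂'⇔b₁ : (x , y) ∈ orderedPairs (swapFront b₂) ⇔ (x , y) ∈ orderedPairs b₁
    b₂'⇔b₁ = ∈-∷-⇔-tail xy∉tail₂ xy∉tail₁ ⇔-∘ ∈-↭-⇔ (orderedPairs-swapFront q p u v)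

  parallel : ¬ (y ≡ p ⊎ y ≡ q) → pairCount (map swapFront (blocks t)) x y ≡ pairCount (blocks t) x y
  parallel y∉pq = pairCount-cong (b₁'⇔b₁ ∷ b₂'⇔b₂ ∷ [])
    where
    xy≢pq : (x , y) ≢ (p , q)
    xy≢pq = y∉pq ∘ inj₂ ∘ cong proj₂
    xy≢qp : (x , y) ≢ (q , p)
    xy≢qp = y∉pq ∘ inj₁ ∘ cong proj₂
    b₁'⇔b₁ : (x , y) ∈ orderedPairs (swapFront b₁) ⇔ (x , y) ∈ orderedPairs b₁
    b₁'⇔b₁ = ∈-∷-⇔-head xy≢qp xy≢pq ⇔-∘ ∈-↭-⇔ (orderedPairs-swapFront p q r s)
    b₂'⇔b₂ : (x , y) ∈ orderedPairs (swapFront b₂) ⇔ (x , y) ∈ orderedPairs b₂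
    b₂'⇔b₂ = ∈-∷-⇔-head xy≢pq xy≢qp ⇔-∘ ∈-↭-⇔ (orderedPairs-swapFront q p u v)

IsDGDD-resp-↭ : ∀ {B B'} → B ↭ B' → IsDGDD B → IsDGDD B'
IsDGDD-resp-↭ B↭B' (good , count) =
  All⇒∀lookup {P = GoodBlock} (All-resp-↭ B↭B' (∀lookup⇒All good)) ,
  λ x y x≁y → trans (sym (pairCount-resp-↭ B↭B' x y)) (count x y x≁y)

IsDGDD-exchange : ∀ t rest → IsDGDD (blocks t ++ rest) → IsDGDD (map swapFront (blocks t) ++ rest)
IsDGDD-exchange t rest (good , count) =
  All⇒∀lookup {P = GoodBlock} (++⁺ (map⁺ {f = swapFront} good-t') (++⁻ʳ (blocks t) goods)) ,
  λ x y x≁y → begin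
    pairCount (map swapFront (blocks t) ++ rest) x y
      ≡⟨ pairCount-++ (map swapFront (blocks t)) rest x y ⟩
    pairCount (map swapFront (blocks t)) x y + pairCount rest x y
      ≡⟨ cong (_+ pairCount rest x y) (pairCount-exchange t good-t x y) ⟩
    pairCount (blocks t) x y + pairCount rest x y
      ≡⟨ pairCount-++ (blocks t) rest x y ⟨
    pairCount (blocks t ++ rest) x y
      ≡⟨ count x y x≁y ⟩
    2 ∎
  where
  open ≡-Reasoning
  goods = ∀lookup⇒All {P = GoodBlock} good
  good-t = ++⁻ˡ (blocks t) goods
  good-t' = All.map (λ {b} → GoodBlock-swapFront {b}) good-t

-- Both directions, as common is symmetric only on blocks with distinct points.
SharesAtMostTwo : Block → Block → Set
SharesAtMostTwo b c = common b c ≤ 2 × common c b ≤ 2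

↭⇒common≡4 : ∀ {b c} → toList b ↭ toList c → common b c ≡ 4
↭⇒common≡4 {_ ∷ _ ∷ _ ∷ _ ∷ []} {c} b↭c =
  cong length (filter-all (λ p → p MP.∈? toList c) (All.tabulate (∈-resp-↭ b↭c)))

↭⇒¬SharesAtMostTwo : ∀ {b c} → toList b ↭ toList c → ¬ SharesAtMostTwo b c
↭⇒¬SharesAtMostTwo {b} {c} b↭c (b∩c≤2 , _)
  with s≤s (s≤s ()) ← subst (_≤ 2) (↭⇒common≡4 {b} {c} b↭c) b∩c≤2

SharesAtMostTwo⇒≢ : ∀ {b c} → SharesAtMostTwo b c → b ≢ c
SharesAtMostTwo⇒≢ {b} b~b refl = ↭⇒¬SharesAtMostTwo {b} ↭-refl b~b

swapFront∉ : ∀ {B b} → AllPairs SharesAtMostTwo B → GoodBlock b → b ∈ B → swapFront b ∉ B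
swapFront∉ {b = a ∷ a' ∷ cs} pairs good b∈B b'∈B with ∈-AllPairs₂ pairs b∈B b'∈B
... | inj₁ b≡b'         = good (# 0) (# 1) (λ ()) (cong group (∷-injectiveˡ b≡b'))
... | inj₂ (inj₁ b~b')  = ↭⇒¬SharesAtMostTwo (↭-swap a a' ↭-refl) b~b'
... | inj₂ (inj₂ b'~b)  = ↭⇒¬SharesAtMostTwo (↭-swap a a' ↭-refl) (Product.swap b'~b)

_≟ᵇ_ : DecidableEquality Block
_≟ᵇ_ = Vecₚ.≡-dec _≟ₚ_

open DecMembership _≟ᵇ_ using () renaming (_∈?_ to _∈ᵇ?_)

definingSet-meets-trade : ∀ {B S t rest} → IsDGDD B → AllPairs SharesAtMostTwo B →
  IsDefiningSet B S → B ↭ blocks t ++ rest → Any (_∈ S) (blocks t)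
definingSet-meets-trade {B} {S} {t} {rest} dgdd pairs (S⊆B , B-unique) B↭t++rest =
  case any? (_∈ᵇ? S) (blocks t) of λ
    { (yes hit) → hit
    ; (no miss) → contradiction (∈-resp-↭ (B-unique B' B'-dgdd (S⊆B' miss)) (here refl))
                                (swapFront∉ pairs good₁ b₁∈B)
    }
  where
  B' = map swapFront (blocks t) ++ rest
  B'-dgdd : IsDGDD B'
  B'-dgdd = IsDGDD-exchange t rest (IsDGDD-resp-↭ B↭t++rest dgdd)
  S⊆B' : ¬ Any (_∈ S) (blocks t) → S ⊆ₘ B'
  S⊆B' miss = ⊆ₘ-++⁺ˡ (map swapFront (blocks t))
                (⊆ₘ-++⁻ (¬Any⇒All¬ (blocks t) miss) (⊆ₘ-resp-↭ B↭t++rest S⊆B))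
  b₁∈B : block₁ t ∈ B
  b₁∈B = ∈-resp-↭ (↭-sym B↭t++rest) (here refl)
  good₁ : GoodBlock (block₁ t)
  good₁ = All.lookup (∀lookup⇒All {P = GoodBlock} (proj₁ dgdd)) b₁∈B

definingSet-length : ∀ ts {S} → IsDGDD (concatMap blocks ts) →
  AllPairs SharesAtMostTwo (concatMap blocks ts) →
  IsDefiningSet (concatMap blocks ts) S → length ts ≤ length S
definingSet-length ts dgdd pairs defining =
  length≤-hittingSet blocks _≟ᵇ_ {ts} (AllPairs.map SharesAtMostTwo⇒≢ pairs)
    (All.tabulate λ t∈ts →
      definingSet-meets-trade dgdd pairs defining (proj₂ (∈-concatMap-↭ blocks t∈ts)))

-- The point i of ℤ₃₀ lies in group i mod 5; each orbit is the development of a base trade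
-- under i ↦ i + 1 (mod 30).
point : ℕ → Point
point i = i mod 5 , (i / 5) mod 6

orbit : ℕ → ℕ → ℕ → ℕ → ℕ → ℕ → List Trade
orbit p q r s u v =
  map (λ i → trade (point (p + i)) (point (q + i)) (point (r + i))
                   (point (s + i)) (point (u + i)) (point (v + i)))
      (upTo 30)

trades : List Trade
trades =
  orbit 0 26 2 8 17 29 ++ orbit 0 21 2 28 13 22 ++
  orbit 0 29 18 16 23 7 ++ orbit 0 16 4 27 19 13

design : List Block
design = concatMap blocks trades

∀Point? : {P : Point → Set} → Decidable P → Dec (∀ x → P x)
∀Point? P? = map′ (λ P[g,i] (g , i) → P[g,i] g i) (λ P[x] g i → P[x] (g , i))
  (Fin.all? λ g → Fin.all? λ i → P? (g , i))

GoodBlock? : Decidable GoodBlock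
GoodBlock? b = Fin.all? λ i → Fin.all? λ j →
  ¬? (i Fin.≟ j) →-dec ¬? (group (Vec.lookup b i) Fin.≟ group (Vec.lookup b j))

SharesAtMostTwo? : ∀ b c → Dec (SharesAtMostTwo b c)
SharesAtMostTwo? b c = (common b c ≤? 2) ×-dec (common c b ≤? 2)

design-isDGDD : IsDGDD design
design-isDGDD =
  All⇒∀lookup {P = GoodBlock} (toWitness {a? = all? GoodBlock? design} _) ,
  toWitness {a? = ∀Point? λ x → ∀Point? λ y →
                    ¬? (group x Fin.≟ group y) →-dec (pairCount design x y ≟ 2)} _

design-sharesAtMostTwo : AllPairs SharesAtMostTwo design
design-sharesAtMostTwo = toWitness {a? = allPairs? SharesAtMostTwo? design} _

design-superSimple : SuperSimple design
design-superSimple k l k≢l = proj₁ (AllPairs-lookup Product.swap design-sharesAtMostTwo k≢l)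

lemma5 : ∃ λ (B : List Block) → IsDGDD B × SuperSimple B ×
           (∀ (S : List Block) → IsDefiningSet B S → length B ≤ 2 * length S)
lemma5 = design , design-isDGDD , design-superSimple , λ S defining →
  *-monoʳ-≤ 2 (definingSet-length trades design-isDGDD design-sharesAtMostTwo defining)
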